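{- For every integer $n\ge 1$, the coefficient of $x^n/n!$ in the formal power series $\dfrac{2\log(1+x)}{2+x}$ equals \[ (-1)^{n-1}\sum_{i=0}^{n-1} i!\,(n-i-1)!. \]
   Context: Coefficients are taken with respect to the basis $x^n/n!$, i.e., the series is regarded as an exponential generating function. -}

module Defs where

open import Data.Nat as ℕ using (ℕ; zero; suc; _∸_)
open import Data.Nat.Combinatorics using ()
open import Data.Integer as ℤ using (ℤ)
open import Data.Rational as ℚ using (ℚ; 0ℚ; 1ℚ; _+_; _*_; -_; 1/_; NonZero)
open import Data.List using (List; []; _∷_; zipWith; map; upTo; foldr)
open import Data.Nat.ListAction as NL using ()

-- Formal power series over ℚ, given by their ordinary coefficients:
-- f n is the coefficient of x^n.
Series : Set
Series = ℕ → ℚ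

coeff : Series → ℕ → ℚ
coeff f n = f n

egfCoeff : Series → ℕ → ℚ
egfCoeff f n = (ℤ.+ (n ℕ.!) ℚ./ 1) * f n

sumℚ : List ℚ → ℚ
sumℚ = foldr _+_ 0ℚ

const : ℚ → Series
const c zero    = c
const c (suc _) = 0ℚ

X : Series
X 1 = 1ℚ
X _ = 0ℚ

_⊕_ : Series → Series → Series
(f ⊕ g) n = f n + g n

_⊛_ : Series → Series → Series
(f ⊛ g) n = sumℚ (map (λ k → f k * g (n ∸ k)) (upTo (suc n)))

log1+x : Series
log1+x zero    = 0ℚ
log1+x (suc m) = ((ℤ.- ℤ.1ℤ) ℤ.^ m) ℚ./ suc m

-- Multiplicative inverse of a series f with f_0 ≠ 0:
-- q_0 = 1/f_0,  q_n = -(1/f_0) Σ_{k=1}^{n} f_k q_{n-k}.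
-- invRev f n = [q_n, q_{n-1}, …, q_0]
module _ (f : Series) .{{nz : NonZero (f 0)}} where
  invRev : ℕ → List ℚ
  invRev zero    = (1/ f 0) ∷ []
  invRev (suc n) =
    (- ((1/ f 0) * sumℚ (zipWith _*_ (map (λ j → f (suc j)) (upTo (suc n))) prev))) ∷ prev
    where prev = invRev n

  inv : Series
  inv zero    = 1/ f 0
  inv (suc n) with invRev (suc n)
  ... | q ∷ _ = q
  ... | []    = 0ℚ

two+x : Series
two+x = const (ℤ.+ 2 ℚ./ 1) ⊕ X

instance
  two+x-nz : NonZero (two+x 0)
  two+x-nz = _

target : Series
target = (const (ℤ.+ 2 ℚ./ 1) ⊛ log1+x) ⊛ inv two+x

rhsSum : ℕ → ℕ
rhsSum n = NL.sum (map (λ i → (i ℕ.!) ℕ.* ((n ∸ i ∸ 1) ℕ.!)) (upTo n))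

rhs : ℕ → ℚ
rhs n = ((ℤ.- ℤ.1ℤ) ℤ.^ (n ∸ 1) ℤ.* ℤ.+ rhsSum n) ℚ./ 1

{-# OPTIONS --safe #-}
-- Write t for the series 2 log(1+x)/(2+x). Since 1/(2+x) is geometric with ratio -1/2,
-- t_{n+1} = log(1+x)_{n+1} - t_n / 2, so e_n = n! t_n satisfies e_0 = 0 and
-- e_{n+1} = (-1)^n n! - (n+1) e_n / 2.  The right-hand side r_n = (-1)^{n-1} S_n, with
-- S_{m+1} = Σ_{i+j=m} i! j!, satisfies the same recurrence: splitting
-- (m+2) i! j! = (i+1)! j! + i! (j+1)! along the antidiagonal i + j = m gives
-- 2 S_{m+2} = 2 (m+1)! + (m+2) S_{m+1}.
module Submission where

open import Defs
open import Algebra.Bundles using (CommutativeSemiring; CommutativeRing)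
open import Data.Nat as ℕ using (ℕ; zero; suc; _∸_; _≥_; _!)
import Data.Nat.Properties as ℕP
import Data.Nat.Tactic.RingSolver as ℕ-Solver
import Data.Nat.ListAction as NL
open import Data.List using (List; []; _∷_; applyUpTo; foldr; map; upTo; zipWith)
open import Data.List.Properties using (map-applyUpTo; map-cong; map-upTo)
open import Data.Integer as ℤ using (ℤ)
import Data.Integer.Properties as ℤP
import Data.Integer.Tactic.RingSolver as ℤ-Solver
open import Data.Product using (∃-syntax; _,_)
open import Relation.Binary.PropositionalEquality

module AntidiagonalSum {c ℓ} (R : CommutativeSemiring c ℓ) where

  open CommutativeSemiring R renaming (refl to ≈-refl; sym to ≈-sym; trans to ≈-trans)
  open import Algebra.Properties.CommutativeSemigroup +-commutativeSemigroup using (interchange)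

  sumAntidiagonal : (ℕ → ℕ → Carrier) → ℕ → Carrier
  sumAntidiagonal g zero    = g 0 0
  sumAntidiagonal g (suc n) = g 0 (suc n) + sumAntidiagonal (λ i → g (suc i)) n

  sumAntidiagonal-sucʳ : ∀ g n →
    sumAntidiagonal g (suc n) ≈ sumAntidiagonal (λ i j → g i (suc j)) n + g (suc n) 0
  sumAntidiagonal-sucʳ g zero    = ≈-refl
  sumAntidiagonal-sucʳ g (suc n) =
    ≈-trans (+-congˡ (sumAntidiagonal-sucʳ (λ i → g (suc i)) n)) (≈-sym (+-assoc _ _ _))

  sumAntidiagonal-cong : ∀ {g h} n → (∀ i j → i ℕ.+ j ≡ n → g i j ≈ h i j) →
    sumAntidiagonal g n ≈ sumAntidiagonal h n
  sumAntidiagonal-cong zero    g≈h = g≈h 0 0 refl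
  sumAntidiagonal-cong (suc n) g≈h =
    +-cong (g≈h 0 (suc n) refl) (sumAntidiagonal-cong n (λ i j eq → g≈h (suc i) j (cong suc eq)))

  sumAntidiagonal-+ : ∀ g h n →
    sumAntidiagonal (λ i j → g i j + h i j) n ≈ sumAntidiagonal g n + sumAntidiagonal h n
  sumAntidiagonal-+ g h zero    = ≈-refl
  sumAntidiagonal-+ g h (suc n) =
    ≈-trans (+-congˡ (sumAntidiagonal-+ (λ i → g (suc i)) (λ i → h (suc i)) n)) (interchange _ _ _ _)

  sumAntidiagonal-*ˡ : ∀ a g n → sumAntidiagonal (λ i j → a * g i j) n ≈ a * sumAntidiagonal g n
  sumAntidiagonal-*ˡ a g zero    = ≈-refl
  sumAntidiagonal-*ˡ a g (suc n) =
    ≈-trans (+-congˡ (sumAntidiagonal-*ˡ a (λ i → g (suc i)) n)) (≈-sym (distribˡ a _ _))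

  foldr-applyUpTo≈sumAntidiagonal : ∀ g n →
    foldr _+_ 0# (applyUpTo (λ i → g i (n ∸ i)) (suc n)) ≈ sumAntidiagonal g n
  foldr-applyUpTo≈sumAntidiagonal g zero    = +-identityʳ _
  foldr-applyUpTo≈sumAntidiagonal g (suc n) = +-congˡ (foldr-applyUpTo≈sumAntidiagonal (λ i → g (suc i)) n)

recurrence-unique : ∀ {a} {A : Set a} (step : ℕ → A → A) {x y : ℕ → A} → x 0 ≡ y 0 →
  (∀ n → x (suc n) ≡ step n (x n)) → (∀ n → y (suc n) ≡ step n (y n)) → ∀ n → x n ≡ y n
recurrence-unique step x₀≡y₀ x-step y-step zero    = x₀≡y₀
recurrence-unique step x₀≡y₀ x-step y-step (suc n) =
  trans (x-step n) (trans (cong (step n) (recurrence-unique step x₀≡y₀ x-step y-step n)) (sym (y-step n)))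

module ℕΣ = AntidiagonalSum ℕP.+-*-commutativeSemiring

factorialConvolution : ℕ → ℕ
factorialConvolution = ℕΣ.sumAntidiagonal (λ i j → i ! ℕ.* j !)

rhsSum-suc : ∀ m → rhsSum (suc m) ≡ factorialConvolution m
rhsSum-suc m = begin
  NL.sum (map (λ i → i ! ℕ.* (suc m ∸ i ∸ 1) !) (upTo (suc m)))
    ≡⟨ cong NL.sum (map-cong (λ i → cong (λ k → i ! ℕ.* k !) (suc∸∸1 i)) (upTo (suc m))) ⟩
  NL.sum (map (λ i → i ! ℕ.* (m ∸ i) !) (upTo (suc m)))
    ≡⟨ cong NL.sum (map-upTo _ (suc m)) ⟩
  NL.sum (applyUpTo (λ i → i ! ℕ.* (m ∸ i) !) (suc m))
    ≡⟨ ℕΣ.foldr-applyUpTo≈sumAntidiagonal (λ i j → i ! ℕ.* j !) m ⟩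
  factorialConvolution m ∎
  where
  open ≡-Reasoning
  suc∸∸1 : ∀ i → suc m ∸ i ∸ 1 ≡ m ∸ i
  suc∸∸1 i = trans (ℕP.∸-+-assoc (suc m) i 1) (cong (suc m ∸_) (ℕP.+-comm i 1))

[1+i]!j!+i![1+j]!≡[2+i+j]i!j! : ∀ i j →
  suc i ! ℕ.* j ! ℕ.+ i ! ℕ.* suc j ! ≡ (2 ℕ.+ (i ℕ.+ j)) ℕ.* (i ! ℕ.* j !)
[1+i]!j!+i![1+j]!≡[2+i+j]i!j! i j = identity i j (i !) (j !)
  where
  identity : ∀ i j a b → (suc i ℕ.* a) ℕ.* b ℕ.+ a ℕ.* (suc j ℕ.* b) ≡ (2 ℕ.+ (i ℕ.+ j)) ℕ.* (a ℕ.* b)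
  identity = ℕ-Solver.solve-∀

factorialConvolution-suc : ∀ m →
  2 ℕ.* factorialConvolution (suc m) ≡ 2 ℕ.* suc m ! ℕ.+ (2 ℕ.+ m) ℕ.* factorialConvolution m
factorialConvolution-suc m = begin
  2 ℕ.* factorialConvolution (suc m)
    ≡⟨ cong (λ y → factorialConvolution (suc m) ℕ.+ (y ℕ.+ 0)) (ℕΣ.sumAntidiagonal-sucʳ g m) ⟩
  (0 ! ℕ.* suc m ! ℕ.+ A) ℕ.+ ((B ℕ.+ suc m ! ℕ.* 0 !) ℕ.+ 0)
    ≡⟨ regroup (suc m !) A B ⟩
  2 ℕ.* suc m ! ℕ.+ (A ℕ.+ B)
    ≡⟨ cong (2 ℕ.* suc m ! ℕ.+_) (sym (ℕΣ.sumAntidiagonal-+ _ _ m)) ⟩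
  2 ℕ.* suc m ! ℕ.+ ℕΣ.sumAntidiagonal (λ i j → suc i ! ℕ.* j ! ℕ.+ i ! ℕ.* suc j !) m
    ≡⟨ cong (2 ℕ.* suc m ! ℕ.+_) (ℕΣ.sumAntidiagonal-cong m (λ i j i+j≡m →
         trans ([1+i]!j!+i![1+j]!≡[2+i+j]i!j! i j) (cong (λ k → (2 ℕ.+ k) ℕ.* (i ! ℕ.* j !)) i+j≡m))) ⟩
  2 ℕ.* suc m ! ℕ.+ ℕΣ.sumAntidiagonal (λ i j → (2 ℕ.+ m) ℕ.* (i ! ℕ.* j !)) m
    ≡⟨ cong (2 ℕ.* suc m ! ℕ.+_) (ℕΣ.sumAntidiagonal-*ˡ (2 ℕ.+ m) _ m) ⟩
  2 ℕ.* suc m ! ℕ.+ (2 ℕ.+ m) ℕ.* factorialConvolution m ∎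
  where
  open ≡-Reasoning
  g : ℕ → ℕ → ℕ
  g i j = i ! ℕ.* j !
  A B : ℕ
  A = ℕΣ.sumAntidiagonal (λ i j → suc i ! ℕ.* j !) m
  B = ℕΣ.sumAntidiagonal (λ i j → i ! ℕ.* suc j !) m
  regroup : ∀ f a b → (1 ℕ.* f ℕ.+ a) ℕ.+ ((b ℕ.+ f ℕ.* 1) ℕ.+ 0) ≡ 2 ℕ.* f ℕ.+ (a ℕ.+ b)
  regroup = ℕ-Solver.solve-∀

rhsℤ : ℕ → ℤ
rhsℤ n = (ℤ.- ℤ.1ℤ) ℤ.^ (n ∸ 1) ℤ.* ℤ.+ rhsSum n

rhsℤ-suc : ∀ n →
  ℤ.+ 2 ℤ.* rhsℤ (suc n) ≡ ℤ.+ 2 ℤ.* (ℤ.+ (n !) ℤ.* (ℤ.- ℤ.1ℤ) ℤ.^ n) ℤ.- ℤ.+ suc n ℤ.* rhsℤ n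
rhsℤ-suc zero    = refl
rhsℤ-suc (suc m) = begin
  ℤ.+ 2 ℤ.* ((ℤ.- ℤ.1ℤ ℤ.* u) ℤ.* ℤ.+ rhsSum (suc (suc m)))
    ≡⟨ cong (λ k → ℤ.+ 2 ℤ.* ((ℤ.- ℤ.1ℤ ℤ.* u) ℤ.* ℤ.+ k)) (rhsSum-suc (suc m)) ⟩
  ℤ.+ 2 ℤ.* ((ℤ.- ℤ.1ℤ ℤ.* u) ℤ.* T₁)
    ≡⟨ pull-sign u T₁ ⟩
  (ℤ.- ℤ.1ℤ ℤ.* u) ℤ.* (ℤ.+ 2 ℤ.* T₁)
    ≡⟨ cong ((ℤ.- ℤ.1ℤ ℤ.* u) ℤ.*_) recurrence ⟩
  (ℤ.- ℤ.1ℤ ℤ.* u) ℤ.* (ℤ.+ 2 ℤ.* F ℤ.+ M ℤ.* T₀)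
    ≡⟨ distribute u F M T₀ ⟩
  ℤ.+ 2 ℤ.* (F ℤ.* (ℤ.- ℤ.1ℤ ℤ.* u)) ℤ.- M ℤ.* (u ℤ.* T₀)
    ≡⟨ cong (λ k → ℤ.+ 2 ℤ.* (F ℤ.* (ℤ.- ℤ.1ℤ ℤ.* u)) ℤ.- M ℤ.* (u ℤ.* ℤ.+ k))
            (sym (rhsSum-suc m)) ⟩
  ℤ.+ 2 ℤ.* (F ℤ.* (ℤ.- ℤ.1ℤ ℤ.* u)) ℤ.- M ℤ.* rhsℤ (suc m) ∎
  where
  open ≡-Reasoning
  u F M T₀ T₁ : ℤ
  u  = (ℤ.- ℤ.1ℤ) ℤ.^ m
  F  = ℤ.+ (suc m !)
  M  = ℤ.+ (2 ℕ.+ m)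
  T₀ = ℤ.+ factorialConvolution m
  T₁ = ℤ.+ factorialConvolution (suc m)
  recurrence : ℤ.+ 2 ℤ.* T₁ ≡ ℤ.+ 2 ℤ.* F ℤ.+ M ℤ.* T₀
  recurrence = begin
    ℤ.+ 2 ℤ.* T₁                             ≡⟨ ℤP.pos-* 2 (factorialConvolution (suc m)) ⟨
    ℤ.+ (2 ℕ.* factorialConvolution (suc m)) ≡⟨ cong ℤ.+_ (factorialConvolution-suc m) ⟩
    ℤ.+ (2 ℕ.* suc m ! ℕ.+ (2 ℕ.+ m) ℕ.* factorialConvolution m)
      ≡⟨ trans (ℤP.pos-+ (2 ℕ.* suc m !) _)
               (cong₂ ℤ._+_ (ℤP.pos-* 2 (suc m !)) (ℤP.pos-* (2 ℕ.+ m) (factorialConvolution m))) ⟩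
    ℤ.+ 2 ℤ.* F ℤ.+ M ℤ.* T₀ ∎
  pull-sign : ∀ u t → ℤ.+ 2 ℤ.* ((ℤ.- ℤ.1ℤ ℤ.* u) ℤ.* t) ≡ (ℤ.- ℤ.1ℤ ℤ.* u) ℤ.* (ℤ.+ 2 ℤ.* t)
  pull-sign = ℤ-Solver.solve-∀
  distribute : ∀ u f m t → (ℤ.- ℤ.1ℤ ℤ.* u) ℤ.* (ℤ.+ 2 ℤ.* f ℤ.+ m ℤ.* t) ≡
               ℤ.+ 2 ℤ.* (f ℤ.* (ℤ.- ℤ.1ℤ ℤ.* u)) ℤ.- m ℤ.* (u ℤ.* t)
  distribute = ℤ-Solver.solve-∀

open import Data.Rational as ℚ using (ℚ; 0ℚ; _+_; _*_; -_; _-_; _/_; 1/_; NonZero; toℚᵘ)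
import Data.Rational.Properties as ℚP
open import Data.Rational.Solver using (module +-*-Solver)
import Data.Rational.Unnormalised as ℚᵘ
import Data.Rational.Unnormalised.Properties as ℚᵘP

ι : ℤ → ℚ
ι i = i / 1

toℚᵘ-ι : ∀ i → toℚᵘ (ι i) ℚᵘ.≃ ℚᵘ.mkℚᵘ i 0
toℚᵘ-ι i = ℚP.toℚᵘ-fromℚᵘ (ℚᵘ.mkℚᵘ i 0)

ι-+ : ∀ a b → ι (a ℤ.+ b) ≡ ι a + ι b
ι-+ a b = ℚP.toℚᵘ-injective (ℚᵘP.≃-trans (toℚᵘ-ι (a ℤ.+ b)) (ℚᵘP.≃-trans (ℚᵘ.*≡* (identity a b))
  (ℚᵘP.≃-sym (ℚᵘP.≃-trans (ℚP.toℚᵘ-homo-+ (ι a) (ι b)) (ℚᵘP.+-cong (toℚᵘ-ι a) (toℚᵘ-ι b))))))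
  where
  identity : ∀ a b → (a ℤ.+ b) ℤ.* ℤ.1ℤ ≡ (a ℤ.* ℤ.1ℤ ℤ.+ b ℤ.* ℤ.1ℤ) ℤ.* ℤ.1ℤ
  identity = ℤ-Solver.solve-∀

ι-* : ∀ a b → ι (a ℤ.* b) ≡ ι a * ι b
ι-* a b = ℚP.toℚᵘ-injective (ℚᵘP.≃-trans (toℚᵘ-ι (a ℤ.* b))
  (ℚᵘP.≃-sym (ℚᵘP.≃-trans (ℚP.toℚᵘ-homo-* (ι a) (ι b)) (ℚᵘP.*-cong (toℚᵘ-ι a) (toℚᵘ-ι b)))))

ι-neg : ∀ a → ι (ℤ.- a) ≡ - ι a
ι-neg a = ℚP.toℚᵘ-injective (ℚᵘP.≃-trans (toℚᵘ-ι (ℤ.- a))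
  (ℚᵘP.≃-sym (ℚᵘP.≃-trans (ℚP.toℚᵘ-homo‿- (ι a)) (ℚᵘP.-‿cong (toℚᵘ-ι a)))))

ι-- : ∀ a b → ι (a ℤ.- b) ≡ ι a - ι b
ι-- a b = trans (ι-+ a (ℤ.- b)) (cong (ι a +_) (ι-neg b))

ι[1+n]*[i/1+n]≡ι[i] : ∀ i n → ι (ℤ.+ suc n) * (i / suc n) ≡ ι i
ι[1+n]*[i/1+n]≡ι[i] i n = ℚP.toℚᵘ-injective (ℚᵘP.≃-trans (ℚP.toℚᵘ-homo-* (ι (ℤ.+ suc n)) (i / suc n))
  (ℚᵘP.≃-trans (ℚᵘP.*-cong (toℚᵘ-ι (ℤ.+ suc n)) (ℚP.toℚᵘ-fromℚᵘ (ℚᵘ.mkℚᵘ i n)))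
  (ℚᵘP.≃-trans (ℚᵘ.*≡* eq) (ℚᵘP.≃-sym (toℚᵘ-ι i)))))
  where
  eq : (ℤ.+ suc n ℤ.* i) ℤ.* ℤ.1ℤ ≡ i ℤ.* ℤ.+ (1 ℕ.* suc n)
  eq = trans (commute (ℤ.+ suc n) i) (cong (λ k → i ℤ.* ℤ.+ k) (sym (ℕP.*-identityˡ (suc n))))
    where
    commute : ∀ m i → (m ℤ.* i) ℤ.* ℤ.1ℤ ≡ i ℤ.* m
    commute = ℤ-Solver.solve-∀

module ℚΣ = AntidiagonalSum (CommutativeRing.commutativeSemiring ℚP.+-*-commutativeRing)

⊛-antidiagonal : ∀ f g n → (f ⊛ g) n ≡ ℚΣ.sumAntidiagonal (λ i j → f i * g j) n
⊛-antidiagonal f g n = trans (cong sumℚ (map-upTo (λ k → f k * g (n ∸ k)) (suc n)))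
                              (ℚΣ.foldr-applyUpTo≈sumAntidiagonal (λ i j → f i * g j) n)

const-⊛ : ∀ c g n → (const c ⊛ g) n ≡ c * g n
const-⊛ c g zero    = ⊛-antidiagonal (const c) g 0
const-⊛ c g (suc n) = begin
  (const c ⊛ g) (suc n)                 ≡⟨ ⊛-antidiagonal (const c) g (suc n) ⟩
  c * g (suc n) + ℚΣ.sumAntidiagonal (λ i j → 0ℚ * g j) n
                                        ≡⟨ cong (c * g (suc n) +_) (ℚΣ.sumAntidiagonal-*ˡ 0ℚ (λ i j → g j) n) ⟩
  c * g (suc n) + 0ℚ * Σg               ≡⟨ cong (c * g (suc n) +_) (ℚP.*-zeroˡ Σg) ⟩
  c * g (suc n) + 0ℚ                    ≡⟨ ℚP.+-identityʳ (c * g (suc n)) ⟩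
  c * g (suc n)                         ∎
  where
  open ≡-Reasoning
  Σg : ℚ
  Σg = ℚΣ.sumAntidiagonal (λ i j → g j) n

⊛-geometricʳ : ∀ f g α → (∀ m → g (suc m) ≡ α * g m) →
  ∀ n → (f ⊛ g) (suc n) ≡ α * (f ⊛ g) n + f (suc n) * g 0
⊛-geometricʳ f g α g-geometric n = begin
  (f ⊛ g) (suc n)
    ≡⟨ trans (⊛-antidiagonal f g (suc n)) (ℚΣ.sumAntidiagonal-sucʳ (λ i j → f i * g j) n) ⟩
  ℚΣ.sumAntidiagonal (λ i j → f i * g (suc j)) n + f (suc n) * g 0
    ≡⟨ cong (_+ f (suc n) * g 0) (ℚΣ.sumAntidiagonal-cong n λ i j _ →
         trans (cong (f i *_) (g-geometric j)) (x∙yz≈y∙xz (f i) α (g j))) ⟩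
  ℚΣ.sumAntidiagonal (λ i j → α * (f i * g j)) n + f (suc n) * g 0
    ≡⟨ cong (_+ f (suc n) * g 0) (trans (ℚΣ.sumAntidiagonal-*ˡ α (λ i j → f i * g j) n)
                                         (cong (α *_) (sym (⊛-antidiagonal f g n)))) ⟩
  α * (f ⊛ g) n + f (suc n) * g 0 ∎
  where
  open ≡-Reasoning
  open import Algebra.Properties.CommutativeSemigroup
    (CommutativeRing.*-commutativeSemigroup ℚP.+-*-commutativeRing) using (x∙yz≈y∙xz)

sumℚ-zipWith-zerosˡ : ∀ {h : ℕ → ℚ} → (∀ k → h k ≡ 0ℚ) → ∀ n (ys : List ℚ) →
  sumℚ (zipWith _*_ (applyUpTo h n) ys) ≡ 0ℚ
sumℚ-zipWith-zerosˡ h≡0 zero    ys       = refl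
sumℚ-zipWith-zerosˡ h≡0 (suc n) []       = refl
sumℚ-zipWith-zerosˡ h≡0 (suc n) (y ∷ ys) =
  trans (cong₂ _+_ (trans (cong (_* y) (h≡0 0)) (ℚP.*-zeroˡ y)) (sumℚ-zipWith-zerosˡ (λ k → h≡0 (suc k)) n ys))
        (ℚP.+-identityˡ 0ℚ)

module _ (f : Series) .{{_ : NonZero (f 0)}} where

  invRev≡inv∷ : ∀ n → ∃[ tl ] invRev f n ≡ inv f n ∷ tl
  invRev≡inv∷ zero    = [] , refl
  invRev≡inv∷ (suc n) = invRev f n , refl

  -- For f = a + b x the recursion for the inverse has a single term, so 1/f is geometric.
  inv-suc-of-linear : (∀ k → f (suc (suc k)) ≡ 0ℚ) → ∀ n → inv f (suc n) ≡ - (1/ f 0 * f 1) * inv f n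
  inv-suc-of-linear f-linear n with invRev f n | invRev≡inv∷ n
  ... | _ | tl , refl = begin
    - (1/ f 0 * (f 1 * inv f n + sumℚ (zipWith _*_ (map (λ j → f (suc j)) (applyUpTo suc n)) tl)))
      ≡⟨ cong (λ s → - (1/ f 0 * (f 1 * inv f n + s)))
              (trans (cong (λ xs → sumℚ (zipWith _*_ xs tl)) (map-applyUpTo suc (λ j → f (suc j)) n))
                     (sumℚ-zipWith-zerosˡ f-linear n tl)) ⟩
    - (1/ f 0 * (f 1 * inv f n + 0ℚ))
      ≡⟨ solve 3 (λ a b q → :- (a :* (b :* q :+ con 0ℚ)) := (:- (a :* b)) :* q) refl (1/ f 0) (f 1) (inv f n) ⟩
    - (1/ f 0 * f 1) * inv f n ∎
    where
    open ≡-Reasoning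
    open +-*-Solver

½ two : ℚ
½   = ℤ.1ℤ / 2
two = ι (ℤ.+ 2)

1/[2+x]-suc : ∀ n → inv two+x (suc n) ≡ - ½ * inv two+x n
1/[2+x]-suc = inv-suc-of-linear two+x (λ _ → refl)

target-suc : ∀ n → target (suc n) ≡ - ½ * target n + log1+x (suc n)
target-suc n = begin
  target (suc n)
    ≡⟨ ⊛-geometricʳ (const two ⊛ log1+x) (inv two+x) (- ½) 1/[2+x]-suc n ⟩
  - ½ * target n + (const two ⊛ log1+x) (suc n) * ½
    ≡⟨ cong (λ c → - ½ * target n + c * ½) (const-⊛ two log1+x (suc n)) ⟩
  - ½ * target n + (two * log1+x (suc n)) * ½
    ≡⟨ solve 2 (λ t l → :- con ½ :* t :+ (con two :* l) :* con ½ := :- con ½ :* t :+ l)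
               refl (target n) (log1+x (suc n)) ⟩
  - ½ * target n + log1+x (suc n) ∎
  where
  open ≡-Reasoning
  open +-*-Solver

recurrenceStep : ℕ → ℚ → ℚ
recurrenceStep n x = ι (ℤ.+ (n !) ℤ.* (ℤ.- ℤ.1ℤ) ℤ.^ n) - ½ * (ι (ℤ.+ suc n) * x)

egfCoeff-target-suc : ∀ n → egfCoeff target (suc n) ≡ recurrenceStep n (egfCoeff target n)
egfCoeff-target-suc n = begin
  ι (ℤ.+ (suc n !)) * target (suc n)
    ≡⟨ cong₂ _*_ (trans (cong ι (ℤP.pos-* (suc n) (n !))) (ι-* (ℤ.+ suc n) (ℤ.+ (n !)))) (target-suc n) ⟩
  (N * F) * (- ½ * target n + l)
    ≡⟨ solve 4 (λ N F t l → (N :* F) :* (:- con ½ :* t :+ l) := F :* (N :* l) :+ :- (con ½ :* (N :* (F :* t))))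
             refl N F (target n) l ⟩
  F * (N * l) - ½ * (N * (F * target n))
    ≡⟨ cong (λ y → F * y - ½ * (N * (F * target n))) (ι[1+n]*[i/1+n]≡ι[i] ((ℤ.- ℤ.1ℤ) ℤ.^ n) n) ⟩
  F * ι ((ℤ.- ℤ.1ℤ) ℤ.^ n) - ½ * (N * (F * target n))
    ≡⟨ cong (_- ½ * (N * (F * target n))) (sym (ι-* (ℤ.+ (n !)) ((ℤ.- ℤ.1ℤ) ℤ.^ n))) ⟩
  recurrenceStep n (egfCoeff target n) ∎
  where
  open ≡-Reasoning
  open +-*-Solver
  N F l : ℚ
  N = ι (ℤ.+ suc n)
  F = ι (ℤ.+ (n !))
  l = log1+x (suc n)

rhs-suc : ∀ n → rhs (suc n) ≡ recurrenceStep n (rhs n)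
rhs-suc n = begin
  ι (rhsℤ (suc n))
    ≡⟨ solve 1 (λ x → x := con ½ :* (con two :* x)) refl (ι (rhsℤ (suc n))) ⟩
  ½ * (two * ι (rhsℤ (suc n)))
    ≡⟨ cong (½ *_) (sym (ι-* (ℤ.+ 2) (rhsℤ (suc n)))) ⟩
  ½ * ι (ℤ.+ 2 ℤ.* rhsℤ (suc n))
    ≡⟨ cong (λ z → ½ * ι z) (rhsℤ-suc n) ⟩
  ½ * ι (ℤ.+ 2 ℤ.* A ℤ.- M ℤ.* rhsℤ n)
    ≡⟨ cong (½ *_) (trans (ι-- (ℤ.+ 2 ℤ.* A) (M ℤ.* rhsℤ n))
                          (cong₂ _-_ (ι-* (ℤ.+ 2) A) (ι-* M (rhsℤ n)))) ⟩
  ½ * (two * ι A - ι M * ι (rhsℤ n))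
    ≡⟨ solve 3 (λ a m r → con ½ :* (con two :* a :+ :- (m :* r)) := a :+ :- (con ½ :* (m :* r)))
             refl (ι A) (ι M) (ι (rhsℤ n)) ⟩
  recurrenceStep n (rhs n) ∎
  where
  open ≡-Reasoning
  open +-*-Solver
  A M : ℤ
  A = ℤ.+ (n !) ℤ.* (ℤ.- ℤ.1ℤ) ℤ.^ n
  M = ℤ.+ suc n

-- The identity also holds for n = 0, where both sides vanish.
mainTheorem2 : (n : ℕ) → n ≥ 1 → egfCoeff target n ≡ rhs n
mainTheorem2 n _ = recurrence-unique recurrenceStep refl egfCoeff-target-suc rhs-suc n
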